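{- Let $\Omega_1,\dots,\Omega_k$ be pairwise disjoint non-empty subsets of $\{1,\dots,n\}$, let $G_i\leq\mathrm{Sym}(\Omega_i)$ for $1\leq i\leq k$, and let $G=G_1\cdot G_2\cdots G_k$ be their internal direct product, acting on $\Omega=\Omega_1\cup\cdots\cup\Omega_k$. If every $G_i$ (acting on $\Omega_i$) has the EKR property, then $G$ has the EKR property.
   Context: The internal direct product $G=G_1\cdots G_k$ consists of the permutations $g_1g_2\cdots g_k$ with $g_i\in G_i$ (these commute since the $\Omega_i$ are disjoint), with multiplication $(g_1\cdots g_k)(h_1\cdots h_k)=(g_1h_1)\cdots(g_kh_k)$, acting on $\Omega$ by $x^{g_1\cdots g_k}=x^{g_i}$ for $x\in\Omega_i$. For a permutation group acting on a set, two elements $\pi,\tau$ intersect if $\pi\tau^{ -1}$ has a fixed point; a subset is intersecting if every pair of its elements intersect. A permutation group has the EKR property if every intersecting subset has size at most the size of the largest point-stabilizer. -}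

module Defs where

open import Data.Nat using (ℕ; zero; suc; _≤_; _⊔_)
open import Data.Bool using (Bool; true; false; if_then_else_)
open import Data.Fin using (Fin; zero; suc)
open import Data.Fin.Properties using () renaming (_≟_ to _≟F_)
open import Data.Fin.Subset using (Subset; _∈_; _∉_; ⋃)
open import Data.Vec using (Vec; lookup; tabulate; allFin)
open import Data.Vec.Properties using (≡-dec)
open import Data.List using (List; []; _∷_; [_]; length; filter; deduplicate; map; concatMap)
import Data.List as L
open import Data.List.Membership.Propositional using () renaming (_∈_ to _∈L_)
open import Data.List.Relation.Unary.Unique.Propositional using (Unique)
open import Data.List.Relation.Unary.All using (All)
open import Data.Product using (Σ; ∃; _×_)
open import Relation.Binary.PropositionalEquality using (_≡_)
open import Function using (id; _∘_)
open import Relation.Nullary using (Dec)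

-- A map Fin n → Fin n, stored as its table (so that ≡ is extensional and decidable).
Tab : ℕ → Set
Tab n = Vec (Fin n) n

_^_ : ∀ {n} → Fin n → Tab n → Fin n
x ^ g = lookup g x

IsPerm : ∀ {n} → Tab n → Set
IsPerm {n} g = (x y : Fin n) → x ^ g ≡ y ^ g → x ≡ y

idT : ∀ {n} → Tab n
idT = tabulate id

-- product in the right-action convention: x ^ (g ⊙ h) = (x ^ g) ^ h
_⊙_ : ∀ {n} → Tab n → Tab n → Tab n
g ⊙ h = tabulate (λ x → (x ^ g) ^ h)

_≟T_ : ∀ {n} (g h : Tab n) → Dec (g ≡ h)
_≟T_ = ≡-dec _≟F_

-- A finite permutation group G ≤ Sym(Δ), Δ ⊆ {0..n-1}, given by a list of its
-- elements (duplicates allowed; the set is the deduplicated list).  Elements of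
-- Sym(Δ) are viewed as permutations of Fin n fixing every point outside Δ.
record IsPermGroupOn {n : ℕ} (Δ : Subset n) (G : List (Tab n)) : Set where
  field
    perm    : All IsPerm G
    support : ∀ {g} → g ∈L G → ∀ x → x ∉ Δ → x ^ g ≡ x
    hasId   : idT ∈L G
    closed  : ∀ {g h} → g ∈L G → h ∈L G → (g ⊙ h) ∈L G

-- π and τ intersect (on Δ): πτ⁻¹ has a fixed point x ∈ Δ, i.e. x^π = x^τ.
Intersect : ∀ {n} → Subset n → Tab n → Tab n → Set
Intersect Δ π τ = ∃ λ x → x ∈ Δ × (x ^ π ≡ x ^ τ)

IsIntersecting : ∀ {n} → Subset n → List (Tab n) → Set
IsIntersecting Δ S = ∀ {π τ} → π ∈L S → τ ∈L S → Intersect Δ π τ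

stabSize : ∀ {n} → List (Tab n) → Fin n → ℕ
stabSize G x = length (deduplicate _≟T_ (filter (λ g → (x ^ g) ≟F x) G))

maxStab : ∀ {n} → Subset n → List (Tab n) → ℕ
maxStab {n} Δ G = L.foldr _⊔_ 0 (L.map (λ x → if lookup Δ x then stabSize G x else 0) (L.allFin n))

HasEKR : ∀ {n} → Subset n → List (Tab n) → Set
HasEKR {n} Δ G = (S : List (Tab n)) → Unique S → All (_∈L G) S → IsIntersecting Δ S → length S ≤ maxStab Δ G

prodList : ∀ {n k} → (Fin k → List (Tab n)) → List (Tab n)
prodList {k = zero}  G = [ idT ]
prodList {k = suc k} G = concatMap (λ g → map (g ⊙_) (prodList (G ∘ suc))) (G zero)

unionΩ : ∀ {n k} → (Fin k → Subset n) → Subset n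
unionΩ {k = k} Ω = ⋃ (L.map Ω (L.allFin k))

-- If G is EKR with largest point stabiliser α, every intersecting family X ⊆ G satisfies
-- |X|·|G| ≤ α·|N[X]|, where N[X] is X together with every element that fails to intersect
-- some member of X: for each g, a largest stabiliser Gₓ with N[X]g removed and Xg added is
-- intersecting, hence |X| ≤ |Gₓ ∩ N[X]g|, and averaging over g gives the bound.
-- In G₁G₂ the elements u₁u₂ and v₁v₂ intersect iff u₁, v₁ or u₂, v₂ do, so an intersecting
-- family S is a set of pairs any two of which intersect in some coordinate.  Following
-- Zhang's argument for independent sets in direct products of graphs, split each fibre
-- {u : uv ∈ S} into the u intersecting the whole fibre and the rest; both kinds of pieces
-- are intersecting in their factor and have disjoint neighbourhoods, so the bound above in
-- both factors yields |S| ≤ max(α₁|G₂|, α₂|G₁|).  Both terms are sizes of stabilisers in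
-- G₁G₂, namely (G₁)ₓ·G₂ and G₁·(G₂)ᵧ, and induction on k ends the proof.

module Submission where

open import Defs
open import Data.Nat using (ℕ; _≤_)
open import Data.Fin using (Fin)
open import Data.Fin.Subset using (Subset; _∈_; Nonempty)
open import Data.List using (List)
open import Data.Empty using (⊥)
open import Relation.Binary.PropositionalEquality using (_≢_)

open import Data.Bool using (Bool; true; false; _∧_; _∨_; not; T; if_then_else_)
open import Data.Bool.ListAction using (any; all)
open import Data.Bool.Properties using (T-∧; T-∨)
open import Data.Empty using (⊥-elim)
open import Data.Fin using (zero; suc)
open import Data.Fin.Properties using (any?) renaming (_≟_ to _≟F_; suc-injective to Fin-suc-injective)
open import Data.Fin.Subset using (_∉_; _∪_; ⋃)
open import Data.Fin.Subset.Properties using (_∈?_; x∈p∪q⁺; x∈p∪q⁻; ∉⊥)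
open import Data.List
  using ([]; _∷_; _++_; length; filter; filterᵇ; map; foldr; allFin; deduplicate; concatMap; cartesianProductWith; cartesianProduct)
open import Data.List.Membership.Propositional using (find; lose) renaming (_∈_ to _∈ₗ_)
open import Data.List.Membership.Propositional.Properties
  using (∈-filter⁺; ∈-filter⁻; ∈-map⁺; ∈-map⁻; ∈-cartesianProductWith⁺; ∈-cartesianProductWith⁻; ∈-allFin; ∈-deduplicate⁺; ∈-deduplicate⁻)
import Data.List.Membership.DecPropositional as DecMembership
open import Data.List.Properties using (filter-notAll; length-filter; length-map; length-++; map-tabulate)
open import Data.List.Relation.Unary.All as All using (All; []; _∷_)
open import Data.List.Relation.Unary.All.Properties using (all⁺; all⁻)
open import Data.List.Relation.Unary.All.Properties.Core using (¬All⇒Any¬)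
open import Data.List.Relation.Unary.Any using (here; there)
import Data.List.Relation.Unary.Any as Any
open import Data.List.Relation.Unary.Any.Properties using (any⁺; any⁻)
open import Data.List.Relation.Unary.Unique.Propositional using (Unique; []; _∷_)
import Data.List.Relation.Unary.Unique.Propositional.Properties as Unique
import Data.List.Relation.Unary.Unique.DecPropositional.Properties as DecUnique
open import Data.Nat using (zero; suc; _+_; _*_; _⊔_; _≤?_; z≤n)
open import Data.Nat.Properties
open import Algebra.Properties.CommutativeSemigroup +-commutativeSemigroup
  using () renaming (interchange to +-interchange)
open import Data.Nat.Solver using (module +-*-Solver)
open import Data.Product using (∃; _×_; _,_; proj₁; proj₂; uncurry)
open import Data.Sum using (_⊎_; inj₁; inj₂)
import Data.Sum as Sum
open import Data.Vec using (lookup)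
open import Data.Vec.Properties using (lookup∘tabulate; tabulate∘lookup; tabulate-cong; []=⇒lookup; lookup⇒[]=)
open import Function using (_∘_; id; Equivalence)
open import Relation.Binary.Definitions using (DecidableEquality)
open import Relation.Binary.PropositionalEquality using (_≡_; refl; sym; trans; cong; cong₂; subst; subst₂; module ≡-Reasoning)
open import Relation.Nullary using (¬_; yes; no; ¬?)
open import Relation.Nullary.Decidable using (Dec; isYes; _×-dec_; toWitness; fromWitness; T?)

open Equivalence using (to; from)

private
  variable
    A B C : Set

∑ : (A → ℕ) → List A → ℕ
∑ f []       = 0
∑ f (x ∷ xs) = f x + ∑ f xs

infix 7 ∑
syntax ∑ (λ x → e) xs = ∑[ x ← xs ] e

∑-cong : ∀ {f g : A → ℕ} xs → (∀ x → f x ≡ g x) → ∑ f xs ≡ ∑ g xs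
∑-cong []       f≗g = refl
∑-cong (x ∷ xs) f≗g = cong₂ _+_ (f≗g x) (∑-cong xs f≗g)

∑-mono-≤ : ∀ {f g : A → ℕ} xs → (∀ {x} → x ∈ₗ xs → f x ≤ g x) → ∑ f xs ≤ ∑ g xs
∑-mono-≤ []       f≤g = z≤n
∑-mono-≤ (x ∷ xs) f≤g = +-mono-≤ (f≤g (here refl)) (∑-mono-≤ xs (f≤g ∘ there))

∑-distrib-+ : ∀ (f g : A → ℕ) xs → ∑[ x ← xs ] (f x + g x) ≡ ∑ f xs + ∑ g xs
∑-distrib-+ f g []       = refl
∑-distrib-+ f g (x ∷ xs) = begin
  f x + g x + ∑[ y ← xs ] (f y + g y) ≡⟨ cong (f x + g x +_) (∑-distrib-+ f g xs) ⟩
  f x + g x + (∑ f xs + ∑ g xs)       ≡⟨ +-interchange (f x) (g x) (∑ f xs) (∑ g xs) ⟩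
  f x + ∑ f xs + (g x + ∑ g xs)       ∎
  where open ≡-Reasoning

∑-*ˡ : ∀ c (f : A → ℕ) xs → ∑[ x ← xs ] (c * f x) ≡ c * ∑ f xs
∑-*ˡ c f []       = sym (*-zeroʳ c)
∑-*ˡ c f (x ∷ xs) = trans (cong (c * f x +_) (∑-*ˡ c f xs)) (sym (*-distribˡ-+ c (f x) (∑ f xs)))

∑-*ʳ : ∀ c (f : A → ℕ) xs → ∑[ x ← xs ] (f x * c) ≡ ∑ f xs * c
∑-*ʳ c f xs = begin
  ∑[ x ← xs ] (f x * c) ≡⟨ ∑-cong xs (λ x → *-comm (f x) c) ⟩
  ∑[ x ← xs ] (c * f x) ≡⟨ ∑-*ˡ c f xs ⟩
  c * ∑ f xs            ≡⟨ *-comm c _ ⟩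
  ∑ f xs * c            ∎
  where open ≡-Reasoning

∑-const : ∀ c (xs : List A) → ∑[ x ← xs ] c ≡ length xs * c
∑-const c []       = refl
∑-const c (x ∷ xs) = cong (c +_) (∑-const c xs)

∑-comm : ∀ (F : A → B → ℕ) xs ys → ∑[ x ← xs ] ∑[ y ← ys ] F x y ≡ ∑[ y ← ys ] ∑[ x ← xs ] F x y
∑-comm F []       ys = sym (trans (∑-const 0 ys) (*-zeroʳ (length ys)))
∑-comm F (x ∷ xs) ys = begin
  ∑ (F x) ys + ∑[ x′ ← xs ] ∑[ y ← ys ] F x′ y ≡⟨ cong (∑ (F x) ys +_) (∑-comm F xs ys) ⟩
  ∑ (F x) ys + ∑[ y ← ys ] ∑[ x′ ← xs ] F x′ y ≡⟨ ∑-distrib-+ (F x) (λ y → ∑[ x′ ← xs ] F x′ y) ys ⟨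
  ∑[ y ← ys ] (F x y + ∑[ x′ ← xs ] F x′ y)    ∎
  where open ≡-Reasoning

∑-++ : ∀ (F : A → ℕ) xs ys → ∑ F (xs ++ ys) ≡ ∑ F xs + ∑ F ys
∑-++ F []       ys = refl
∑-++ F (x ∷ xs) ys = trans (cong (F x +_) (∑-++ F xs ys)) (sym (+-assoc (F x) _ _))

∑-map : ∀ (F : B → ℕ) (f : A → B) xs → ∑ F (map f xs) ≡ ∑ (F ∘ f) xs
∑-map F f []       = refl
∑-map F f (x ∷ xs) = cong (F (f x) +_) (∑-map F f xs)

∑-cartesianProductWith : ∀ (F : C → ℕ) (f : A → B → C) xs ys →
                         ∑ F (cartesianProductWith f xs ys) ≡ ∑[ x ← xs ] ∑[ y ← ys ] F (f x y)
∑-cartesianProductWith F f []       ys = refl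
∑-cartesianProductWith F f (x ∷ xs) ys = begin
  ∑ F (map (f x) ys ++ cartesianProductWith f xs ys)        ≡⟨ ∑-++ F (map (f x) ys) _ ⟩
  ∑ F (map (f x) ys) + ∑ F (cartesianProductWith f xs ys)   ≡⟨ cong₂ _+_ (∑-map F (f x) ys) (∑-cartesianProductWith F f xs ys) ⟩
  ∑ (F ∘ f x) ys + ∑[ x′ ← xs ] ∑[ y ← ys ] F (f x′ y)      ∎
  where open ≡-Reasoning

𝟙 : Bool → ℕ
𝟙 true  = 1
𝟙 false = 0

count : (A → Bool) → List A → ℕ
count P xs = ∑[ x ← xs ] 𝟙 (P x)

length-filterᵇ : ∀ (P : A → Bool) xs → length (filterᵇ P xs) ≡ count P xs
length-filterᵇ P []       = refl
length-filterᵇ P (x ∷ xs) with P x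
... | true  = cong suc (length-filterᵇ P xs)
... | false = length-filterᵇ P xs

count≤length : ∀ (P : A → Bool) xs → count P xs ≤ length xs
count≤length P xs = subst (_≤ length xs) (length-filterᵇ P xs) (length-filter (T? ∘ P) xs)

count-true : ∀ (xs : List A) → count (λ _ → true) xs ≡ length xs
count-true xs = trans (∑-const 1 xs) (*-identityʳ (length xs))

count-∨ : ∀ (P Q : A → Bool) xs → (∀ {x} → x ∈ₗ xs → T (P x) → T (Q x) → ⊥) →
          count P xs + count Q xs ≡ count (λ x → P x ∨ Q x) xs
count-∨ P Q []       disjoint = refl
count-∨ P Q (x ∷ xs) disjoint with P x | Q x | disjoint (here refl) | count-∨ P Q xs (disjoint ∘ there)
... | true  | true  | x∉P∩Q | _  = ⊥-elim (x∉P∩Q _ _)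
... | true  | false | _     | ih = cong suc ih
... | false | true  | _     | ih = trans (+-suc (count P xs) (count Q xs)) (cong suc ih)
... | false | false | _     | ih = ih

count-∧-split : ∀ (P Q : A → Bool) xs → count P xs ≡ count (λ x → P x ∧ Q x) xs + count (λ x → P x ∧ not (Q x)) xs
count-∧-split P Q []       = refl
count-∧-split P Q (x ∷ xs) with P x | Q x | count-∧-split P Q xs
... | true  | true  | ih = cong suc ih
... | true  | false | ih = trans (cong suc ih) (sym (+-suc _ _))
... | false | _     | ih = ih

length-cartesianProductWith : ∀ (f : A → B → C) xs ys → length (cartesianProductWith f xs ys) ≡ length xs * length ys
length-cartesianProductWith f []       ys = refl
length-cartesianProductWith f (x ∷ xs) ys =
  trans (length-++ (map (f x) ys)) (cong₂ _+_ (length-map (f x) ys) (length-cartesianProductWith f xs ys))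

Unique-map⁺ : ∀ (f : A → B) {xs} → Unique xs → (∀ {x x′} → x ∈ₗ xs → x′ ∈ₗ xs → f x ≡ f x′ → x ≡ x′) →
              Unique (map f xs)
Unique-map⁺ f {[]}     _            _     = []
Unique-map⁺ f {x ∷ xs} (x∉xs ∷ xs!) f-inj =
  All.tabulate fx∉ ∷ Unique-map⁺ f xs! (λ x∈ x′∈ → f-inj (there x∈) (there x′∈))
  where
  fx∉ : ∀ {y} → y ∈ₗ map f xs → f x ≢ y
  fx∉ y∈ fx≡y with ∈-map⁻ f y∈
  ... | x′ , x′∈xs , refl = All.lookup x∉xs x′∈xs (f-inj (here refl) (there x′∈xs) fx≡y)

Unique-cartesianProductWith : ∀ (f : A → B → C) {xs ys} → Unique xs → Unique ys →
  (∀ {x x′ y y′} → x ∈ₗ xs → x′ ∈ₗ xs → y ∈ₗ ys → y′ ∈ₗ ys → f x y ≡ f x′ y′ → x ≡ x′ × y ≡ y′) →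
  Unique (cartesianProductWith f xs ys)
Unique-cartesianProductWith f {[]}     _            _   _     = []
Unique-cartesianProductWith f {x ∷ xs} {ys} (x∉xs ∷ xs!) ys! f-inj =
  Unique.++⁺ (Unique-map⁺ (f x) ys! (λ y∈ y′∈ fxy≡fxy′ → proj₂ (f-inj (here refl) (here refl) y∈ y′∈ fxy≡fxy′)))
             (Unique-cartesianProductWith f xs! ys! (λ x∈ x′∈ → f-inj (there x∈) (there x′∈)))
             row-disjoint
  where
  row-disjoint : ∀ {z} → ¬ (z ∈ₗ map (f x) ys × z ∈ₗ cartesianProductWith f xs ys)
  row-disjoint (z∈row , z∈rest) with ∈-map⁻ (f x) z∈row | ∈-cartesianProductWith⁻ f xs ys z∈rest
  ... | y , y∈ys , refl | x′ , y′ , x′∈xs , y′∈ys , fxy≡fx′y′ =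
    All.lookup x∉xs x′∈xs (proj₁ (f-inj (here refl) (there x′∈xs) y∈ys y′∈ys fxy≡fx′y′))

module _ (_≟_ : DecidableEquality A) where

  open DecMembership _≟_ using () renaming (_∈?_ to _∈ₗ?_)

  ⊆⇒length≤ : ∀ {xs ys : List A} → Unique xs → (∀ {x} → x ∈ₗ xs → x ∈ₗ ys) → length xs ≤ length ys
  ⊆⇒length≤ {[]}     _            _       = z≤n
  ⊆⇒length≤ {x ∷ xs} {ys} (x∉xs ∷ xs!) x∷xs⊆ys = begin-strict
    length xs                         ≤⟨ ⊆⇒length≤ xs! xs⊆ys∖x ⟩
    length (filter (¬? ∘ (x ≟_)) ys)  <⟨ filter-notAll (¬? ∘ (x ≟_)) ys (Any.map (λ x≡y x≢y → x≢y x≡y) (x∷xs⊆ys (here refl))) ⟩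
    length ys                         ∎
    where
    open ≤-Reasoning
    xs⊆ys∖x : ∀ {y} → y ∈ₗ xs → y ∈ₗ filter (¬? ∘ (x ≟_)) ys
    xs⊆ys∖x y∈xs = ∈-filter⁺ (¬? ∘ (x ≟_)) (x∷xs⊆ys (there y∈xs)) (All.lookup x∉xs y∈xs)

  ⊆∧length≥⇒⊇ : ∀ {xs ys : List A} → Unique xs → (∀ {x} → x ∈ₗ xs → x ∈ₗ ys) → length ys ≤ length xs →
                ∀ {y} → y ∈ₗ ys → y ∈ₗ xs
  ⊆∧length≥⇒⊇ {xs} {ys} xs! xs⊆ys ys≤xs {y} y∈ys with y ∈ₗ? xs
  ... | yes y∈xs = y∈xs
  ... | no  y∉xs = ⊥-elim (<⇒≱ (⊆⇒length≤ y∷xs! y∷xs⊆ys) ys≤xs)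
    where
    y∷xs! : Unique (y ∷ xs)
    y∷xs! = All.tabulate (λ { x∈xs refl → y∉xs x∈xs }) ∷ xs!
    y∷xs⊆ys : ∀ {x} → x ∈ₗ y ∷ xs → x ∈ₗ ys
    y∷xs⊆ys (here refl) = y∈ys
    y∷xs⊆ys (there x∈xs) = xs⊆ys x∈xs

  count-≤-surjection : ∀ (f : B → A) {P : A → Bool} {Q : B → Bool} {xs ys} → Unique xs →
    (∀ {x} → x ∈ₗ xs → T (P x) → ∃ λ y → y ∈ₗ ys × T (Q y) × f y ≡ x) → count P xs ≤ count Q ys
  count-≤-surjection f {P} {Q} {xs} {ys} xs! onto = begin
    count P xs                     ≡⟨ length-filterᵇ P xs ⟨
    length (filterᵇ P xs)          ≤⟨ ⊆⇒length≤ (Unique.filter⁺ (T? ∘ P) xs!) P⊆f[Q] ⟩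
    length (map f (filterᵇ Q ys))  ≡⟨ length-map f (filterᵇ Q ys) ⟩
    length (filterᵇ Q ys)          ≡⟨ length-filterᵇ Q ys ⟩
    count Q ys                     ∎
    where
    open ≤-Reasoning
    P⊆f[Q] : ∀ {x} → x ∈ₗ filterᵇ P xs → x ∈ₗ map f (filterᵇ Q ys)
    P⊆f[Q] x∈ with ∈-filter⁻ (T? ∘ P) x∈
    ... | x∈xs , Px with onto x∈xs Px
    ... | y , y∈ys , Qy , refl = ∈-map⁺ f (∈-filter⁺ (T? ∘ Q) y∈ys Qy)

  count-≤-injection : ∀ (f : B → A) {P : B → Bool} {Q : A → Bool} {xs ys} → Unique xs →
    (∀ {x y} → f x ≡ f y → x ≡ y) → (∀ {x} → x ∈ₗ xs → T (P x) → f x ∈ₗ ys × T (Q (f x))) →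
    count P xs ≤ count Q ys
  count-≤-injection f {P} {Q} {xs} {ys} xs! f-inj into = begin
    count P xs                     ≡⟨ length-filterᵇ P xs ⟨
    length (filterᵇ P xs)          ≡⟨ length-map f (filterᵇ P xs) ⟨
    length (map f (filterᵇ P xs))  ≤⟨ ⊆⇒length≤ (Unique.map⁺ f-inj (Unique.filter⁺ (T? ∘ P) xs!)) f[P]⊆Q ⟩
    length (filterᵇ Q ys)          ≡⟨ length-filterᵇ Q ys ⟩
    count Q ys                     ∎
    where
    open ≤-Reasoning
    f[P]⊆Q : ∀ {y} → y ∈ₗ map f (filterᵇ P xs) → y ∈ₗ filterᵇ Q ys
    f[P]⊆Q y∈ with ∈-map⁻ f y∈
    ... | x , x∈ , refl with ∈-filter⁻ (T? ∘ P) x∈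
    ... | x∈xs , Px = let fx∈ys , Qfx = into x∈xs Px in ∈-filter⁺ (T? ∘ Q) fx∈ys Qfx

  count-product≤ : ∀ (f : B → C → A) {P : B → Bool} {Q : C → Bool} {R : A → Bool} {xs ys zs} →
    Unique xs → Unique ys →
    (∀ {x x′ y y′} → x ∈ₗ xs → x′ ∈ₗ xs → y ∈ₗ ys → y′ ∈ₗ ys → f x y ≡ f x′ y′ → x ≡ x′ × y ≡ y′) →
    (∀ {x y} → x ∈ₗ xs → y ∈ₗ ys → T (P x) → T (Q y) → f x y ∈ₗ zs × T (R (f x y))) →
    count P xs * count Q ys ≤ count R zs
  count-product≤ f {P} {Q} {R} {xs} {ys} {zs} xs! ys! f-inj into = begin
    count P xs * count Q ys                                        ≡⟨ cong₂ _*_ (length-filterᵇ P xs) (length-filterᵇ Q ys) ⟨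
    length (filterᵇ P xs) * length (filterᵇ Q ys)                  ≡⟨ length-cartesianProductWith f (filterᵇ P xs) _ ⟨
    length (cartesianProductWith f (filterᵇ P xs) (filterᵇ Q ys))  ≤⟨ ⊆⇒length≤ P×Q! P×Q⊆R ⟩
    length (filterᵇ R zs)                                          ≡⟨ length-filterᵇ R zs ⟩
    count R zs                                                     ∎
    where
    open ≤-Reasoning
    filter⊆ : ∀ {D : Set} {S : D → Bool} {ds d} → d ∈ₗ filterᵇ S ds → d ∈ₗ ds
    filter⊆ {S = S} = proj₁ ∘ ∈-filter⁻ (T? ∘ S)
    P×Q! : Unique (cartesianProductWith f (filterᵇ P xs) (filterᵇ Q ys))
    P×Q! = Unique-cartesianProductWith f (Unique.filter⁺ (T? ∘ P) xs!) (Unique.filter⁺ (T? ∘ Q) ys!)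
             (λ x∈ x′∈ y∈ y′∈ → f-inj (filter⊆ x∈) (filter⊆ x′∈) (filter⊆ y∈) (filter⊆ y′∈))
    P×Q⊆R : ∀ {z} → z ∈ₗ cartesianProductWith f (filterᵇ P xs) (filterᵇ Q ys) → z ∈ₗ filterᵇ R zs
    P×Q⊆R z∈ with ∈-cartesianProductWith⁻ f (filterᵇ P xs) (filterᵇ Q ys) z∈
    ... | x , y , x∈ , y∈ , refl with ∈-filter⁻ (T? ∘ P) x∈ | ∈-filter⁻ (T? ∘ Q) y∈
    ... | x∈xs , Px | y∈ys , Qy = let fxy∈zs , Rfxy = into x∈xs y∈ys Px Qy in ∈-filter⁺ (T? ∘ R) fxy∈zs Rfxy

T-not⁺ : ∀ {b} → ¬ T b → T (not b)
T-not⁺ {false} _  = _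
T-not⁺ {true}  ¬b = ¬b _

T-not⁻ : ∀ {b} → T (not b) → ¬ T b
T-not⁻ {false} _ ()

_⇒ᵇ_ : Bool → Bool → Bool
a ⇒ᵇ b = not a ∨ b

⇒ᵇ-elim : ∀ {a b} → T (a ⇒ᵇ b) → T a → T b
⇒ᵇ-elim {true} a⇒b _ = a⇒b

⇒ᵇ-counterexample : ∀ {a b} → ¬ T (a ⇒ᵇ b) → T a × ¬ T b
⇒ᵇ-counterexample {false}        ¬a⇒b = ⊥-elim (¬a⇒b _)
⇒ᵇ-counterexample {true} {true}  ¬a⇒b = ⊥-elim (¬a⇒b _)
⇒ᵇ-counterexample {true} {false} _    = _ , λ ()

module _ (p : A → Bool) where

  any-witness : ∀ xs → T (any p xs) → ∃ λ x → x ∈ₗ xs × T (p x)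
  any-witness xs = find ∘ any⁻ p xs

  any-intro : ∀ {x xs} → x ∈ₗ xs → T (p x) → T (any p xs)
  any-intro x∈xs px = any⁺ p (lose x∈xs px)

  all-counterexample : ∀ xs → ¬ T (all p xs) → ∃ λ x → x ∈ₗ xs × ¬ T (p x)
  all-counterexample xs ¬all = find (¬All⇒Any¬ (T? ∘ p) xs (¬all ∘ all⁻ p))

module _ (meets : A → A → Bool) (U : List A) where

  Intersecting : (A → Bool) → Set
  Intersecting X = ∀ {x y} → x ∈ₗ U → y ∈ₗ U → T (X x) → T (X y) → T (meets x y)

  -- N[X] in the derangement graph, whose edges join elements that do not meet.
  closedNbhd : (A → Bool) → A → Bool
  closedNbhd X u = X u ∨ any (λ y → X y ∧ not (meets u y)) U

  closedNbhd⁺ˡ : ∀ {X u} → T (X u) → T (closedNbhd X u)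
  closedNbhd⁺ˡ Xu = from T-∨ (inj₁ Xu)

  closedNbhd⁺ʳ : ∀ {X u y} → y ∈ₗ U → T (X y) → ¬ T (meets u y) → T (closedNbhd X u)
  closedNbhd⁺ʳ y∈U Xy u∤y = from T-∨ (inj₂ (any-intro _ y∈U (from T-∧ (Xy , T-not⁺ u∤y))))

  closedNbhd⁻ : ∀ {X u} → T (closedNbhd X u) → T (X u) ⊎ ∃ λ y → y ∈ₗ U × T (X y) × ¬ T (meets u y)
  closedNbhd⁻ {X} {u} N[X]u with to T-∨ N[X]u
  ... | inj₁ Xu      = inj₁ Xu
  ... | inj₂ nearX with any-witness _ U nearX
  ... | y , y∈U , Xy∧u∤y = let Xy , u∤y = to T-∧ Xy∧u∤y in inj₂ (y , y∈U , Xy , T-not⁻ u∤y)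

  NeighbourhoodBound : ℕ → Set
  NeighbourhoodBound α = ∀ X → Intersecting X → count X U * length U ≤ α * count (closedNbhd X) U

module ProductBound
  {A B : Set} (UA : List A) (UB : List B)
  (meetsA : A → A → Bool) (meetsB : B → B → Bool)
  (meetsA-sym : ∀ {x y} → T (meetsA x y) → T (meetsA y x))
  (meetsB-sym : ∀ {x y} → T (meetsB x y) → T (meetsB y x))
  (αA αB : ℕ) (boundA : NeighbourhoodBound meetsA UA αA) (boundB : NeighbourhoodBound meetsB UB αB)
  (I : A → B → Bool)
  (I-intersecting : ∀ {u u′ v v′} → u ∈ₗ UA → u′ ∈ₗ UA → v ∈ₗ UB → v′ ∈ₗ UB →
                    T (I u v) → T (I u′ v′) → T (meetsA u u′) ⊎ T (meetsB v v′))
  where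

  a b : ℕ
  a = length UA
  b = length UB

  meetsFibre : A → B → Bool
  meetsFibre u v = all (λ u′ → I u′ v ⇒ᵇ meetsA u u′) UA

  central : B → A → Bool
  central v u = I u v ∧ meetsFibre u v

  offCentre : A → B → Bool
  offCentre u v = I u v ∧ not (meetsFibre u v)

  central⁻ : ∀ {v u} → T (central v u) → T (I u v) × T (meetsFibre u v)
  central⁻ {v} {u} = to (T-∧ {I u v})

  offCentre⁻ : ∀ {u v} → T (offCentre u v) → T (I u v) × ¬ T (meetsFibre u v)
  offCentre⁻ {u} {v} ou = let Iuv , ¬m = to (T-∧ {I u v}) ou in Iuv , T-not⁻ ¬m

  central-meets : ∀ {x u v} → u ∈ₗ UA → T (central v x) → T (I u v) → T (meetsA x u)
  central-meets u∈UA cx Iuv = ⇒ᵇ-elim (All.lookup (all⁺ _ UA (proj₂ (central⁻ cx))) u∈UA) Iuv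

  offCentre-witness : ∀ {u v} → T (offCentre u v) → ∃ λ u′ → u′ ∈ₗ UA × T (I u′ v) × ¬ T (meetsA u u′)
  offCentre-witness ou with all-counterexample _ UA (proj₂ (offCentre⁻ ou))
  ... | u′ , u′∈UA , ¬[Iu′v⇒u∩u′] = u′ , u′∈UA , ⇒ᵇ-counterexample ¬[Iu′v⇒u∩u′]

  central-intersecting : ∀ v → Intersecting meetsA UA (central v)
  central-intersecting v x∈UA y∈UA cx cy = central-meets y∈UA cx (proj₁ (central⁻ cy))

  offCentre-intersecting : ∀ {u} → u ∈ₗ UA → Intersecting meetsB UB (offCentre u)
  offCentre-intersecting u∈UA v∈UB v′∈UB ov ov′
    with offCentre-witness ov
  ... | u′ , u′∈UA , Iu′v , u∤u′
    with I-intersecting u′∈UA u∈UA v∈UB v′∈UB Iu′v (proj₁ (offCentre⁻ ov′))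
  ... | inj₁ u′∩u = ⊥-elim (u∤u′ (meetsA-sym u′∩u))
  ... | inj₂ v∩v′ = v∩v′

  closedNbhds-disjoint : ∀ {u v} → u ∈ₗ UA → v ∈ₗ UB →
    T (closedNbhd meetsA UA (central v) u) → T (closedNbhd meetsB UB (offCentre u) v) → ⊥
  closedNbhds-disjoint u∈UA v∈UB N[cv]u N[ou]v
    with closedNbhd⁻ meetsA UA N[cv]u | closedNbhd⁻ meetsB UB N[ou]v
  ... | inj₁ cu | inj₁ ou = proj₂ (offCentre⁻ ou) (proj₂ (central⁻ cu))
  ... | inj₁ cu | inj₂ (v′ , v′∈UB , ov′ , v∤v′) with offCentre-witness ov′
  ... | u′ , u′∈UA , Iu′v′ , u∤u′ with I-intersecting u′∈UA u∈UA v′∈UB v∈UB Iu′v′ (proj₁ (central⁻ cu))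
  ... | inj₁ u′∩u = u∤u′ (meetsA-sym u′∩u)
  ... | inj₂ v′∩v = v∤v′ (meetsB-sym v′∩v)
  closedNbhds-disjoint u∈UA v∈UB _ _ | inj₂ (x , _ , cx , u∤x) | inj₁ ou =
    u∤x (meetsA-sym (central-meets u∈UA cx (proj₁ (offCentre⁻ ou))))
  closedNbhds-disjoint u∈UA v∈UB _ _ | inj₂ (x , x∈UA , cx , u∤x) | inj₂ (v′ , v′∈UB , ov′ , v∤v′)
    with I-intersecting x∈UA u∈UA v∈UB v′∈UB (proj₁ (central⁻ cx)) (proj₁ (offCentre⁻ ov′))
  ... | inj₁ x∩u = u∤x (meetsA-sym x∩u)
  ... | inj₂ v∩v′ = v∤v′ v∩v′

  size P Q X Y : ℕ
  size = ∑[ u ← UA ] count (I u) UB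
  P    = ∑[ v ← UB ] count (central v) UA
  Q    = ∑[ u ← UA ] count (offCentre u) UB
  X    = ∑[ v ← UB ] count (closedNbhd meetsA UA (central v)) UA
  Y    = ∑[ v ← UB ] count (λ u → closedNbhd meetsB UB (offCentre u) v) UA

  size≡P+Q : size ≡ P + Q
  size≡P+Q = begin
    ∑[ u ← UA ] count (I u) UB                                              ≡⟨ ∑-cong UA (λ u → count-∧-split (I u) (meetsFibre u) UB) ⟩
    ∑[ u ← UA ] (count (λ v → central v u) UB + count (offCentre u) UB)    ≡⟨ ∑-distrib-+ _ _ UA ⟩
    ∑[ u ← UA ] count (λ v → central v u) UB + Q                            ≡⟨ cong (_+ Q) (∑-comm (λ u v → 𝟙 (central v u)) UA UB) ⟩
    P + Q                                                                   ∎
    where open ≡-Reasoning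

  P*a≤αA*X : P * a ≤ αA * X
  P*a≤αA*X = subst₂ _≤_ (∑-*ʳ a _ UB) (∑-*ˡ αA _ UB)
               (∑-mono-≤ UB (λ {v} _ → boundA (central v) (central-intersecting v)))

  Q*b≤αB*Y : Q * b ≤ αB * Y
  Q*b≤αB*Y = subst₂ _≤_ (∑-*ʳ b _ UA)
               (trans (∑-*ˡ αB _ UA) (cong (αB *_) (∑-comm (λ u v → 𝟙 (closedNbhd meetsB UB (offCentre u) v)) UA UB)))
               (∑-mono-≤ UA (λ {u} u∈UA → boundB (offCentre u) (offCentre-intersecting u∈UA)))

  X+Y≤b*a : X + Y ≤ b * a
  X+Y≤b*a = subst₂ _≤_ (∑-distrib-+ _ _ UB) (∑-const a UB) (∑-mono-≤ UB X+Y≤a)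
    where
    X+Y≤a : ∀ {v} → v ∈ₗ UB → count (closedNbhd meetsA UA (central v)) UA + count (λ u → closedNbhd meetsB UB (offCentre u) v) UA ≤ a
    X+Y≤a v∈UB = subst (_≤ a) (sym (count-∨ _ _ UA (λ u∈UA → closedNbhds-disjoint u∈UA v∈UB))) (count≤length _ UA)

  size≤a*b : size ≤ a * b
  size≤a*b = subst (size ≤_) (∑-const b UA) (∑-mono-≤ UA (λ {u} _ → count≤length (I u) UB))

  size≤αA*b : αB * a ≤ αA * b → size ≤ αA * b
  size≤αA*b αB*a≤αA*b with a * b in a*b≡ab
  ... | zero  = ≤-trans size≤a*b (subst (_≤ αA * b) (sym a*b≡ab) z≤n)
  ... | suc m = *-cancelʳ-≤ size (αA * b) (suc m) (subst (λ ab → size * ab ≤ αA * b * ab) a*b≡ab size*ab≤αA*b*ab)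
    where
    open +-*-Solver
    size*ab≤αA*b*ab : size * (a * b) ≤ αA * b * (a * b)
    size*ab≤αA*b*ab = begin
      size * (a * b)                   ≡⟨ cong (_* (a * b)) size≡P+Q ⟩
      (P + Q) * (a * b)                ≡⟨ solve 4 (λ p q x y → (p :+ q) :* (x :* y) := (p :* x) :* y :+ (q :* y) :* x) refl P Q a b ⟩
      P * a * b + Q * b * a            ≤⟨ +-mono-≤ (*-monoˡ-≤ b P*a≤αA*X) (*-monoˡ-≤ a Q*b≤αB*Y) ⟩
      αA * X * b + αB * Y * a          ≡⟨ solve 6 (λ X′ Y′ c d x y → c :* X′ :* y :+ d :* Y′ :* x := y :* c :* X′ :+ d :* x :* Y′) refl X Y αA αB a b ⟩
      b * αA * X + αB * a * Y          ≤⟨ +-monoʳ-≤ (b * αA * X) (*-monoˡ-≤ Y (subst (αB * a ≤_) (*-comm αA b) αB*a≤αA*b)) ⟩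
      b * αA * X + b * αA * Y          ≡⟨ *-distribˡ-+ (b * αA) X Y ⟨
      b * αA * (X + Y)                 ≤⟨ *-monoʳ-≤ (b * αA) X+Y≤b*a ⟩
      b * αA * (b * a)                 ≡⟨ solve 3 (λ x y z → y :* x :* (y :* z) := x :* y :* (z :* y)) refl αA b a ⟩
      αA * b * (a * b)                 ∎
      where open ≤-Reasoning

module _ {n : ℕ} where

  ^-⊙ : ∀ (x : Fin n) g h → x ^ (g ⊙ h) ≡ (x ^ g) ^ h
  ^-⊙ x g h = lookup∘tabulate (λ y → (y ^ g) ^ h) x

  ^-idT : ∀ (x : Fin n) → x ^ idT ≡ x
  ^-idT = lookup∘tabulate (λ y → y)

  Tab-ext : ∀ {g h : Tab n} → (∀ x → x ^ g ≡ x ^ h) → g ≡ h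
  Tab-ext {g} {h} g≗h = trans (sym (tabulate∘lookup g)) (trans (tabulate-cong g≗h) (tabulate∘lookup h))

  ⊙-assoc : ∀ (f g h : Tab n) → (f ⊙ g) ⊙ h ≡ f ⊙ (g ⊙ h)
  ⊙-assoc f g h = Tab-ext λ x → begin
    x ^ ((f ⊙ g) ⊙ h)  ≡⟨ ^-⊙ x (f ⊙ g) h ⟩
    (x ^ (f ⊙ g)) ^ h  ≡⟨ cong (_^ h) (^-⊙ x f g) ⟩
    ((x ^ f) ^ g) ^ h  ≡⟨ ^-⊙ (x ^ f) g h ⟨
    (x ^ f) ^ (g ⊙ h)  ≡⟨ ^-⊙ x f (g ⊙ h) ⟨
    x ^ (f ⊙ (g ⊙ h))  ∎
    where open ≡-Reasoning

  ⊙-identityˡ : ∀ (g : Tab n) → idT ⊙ g ≡ g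
  ⊙-identityˡ g = Tab-ext λ x → trans (^-⊙ x idT g) (cong (_^ g) (^-idT x))

  ⊙-identityʳ : ∀ (g : Tab n) → g ⊙ idT ≡ g
  ⊙-identityʳ g = Tab-ext λ x → trans (^-⊙ x g idT) (^-idT (x ^ g))

  ⊙-cancelʳ : ∀ {g : Tab n} → IsPerm g → ∀ {u u′ : Tab n} → u ⊙ g ≡ u′ ⊙ g → u ≡ u′
  ⊙-cancelʳ {g} g-inj {u} {u′} ug≡u′g = Tab-ext λ x →
    g-inj (x ^ u) (x ^ u′) (trans (sym (^-⊙ x u g)) (trans (cong (x ^_) ug≡u′g) (^-⊙ x u′ g)))

  IsPerm-⊙ : ∀ {g h : Tab n} → IsPerm g → IsPerm h → IsPerm (g ⊙ h)
  IsPerm-⊙ {g} {h} g-inj h-inj x y xgh≡ygh =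
    g-inj x y (h-inj (x ^ g) (y ^ g) (trans (sym (^-⊙ x g h)) (trans xgh≡ygh (^-⊙ y g h))))

  support-closed : ∀ {Δ : Subset n} {g : Tab n} → IsPerm g → (∀ x → x ∉ Δ → x ^ g ≡ x) →
                   ∀ {x} → x ∈ Δ → x ^ g ∈ Δ
  support-closed {Δ} {g} g-inj g-support {x} x∈Δ with (x ^ g) ∈? Δ
  ... | yes xg∈Δ = xg∈Δ
  ... | no  xg∉Δ = ⊥-elim (xg∉Δ (subst (_∈ Δ) (sym (g-inj (x ^ g) x (g-support (x ^ g) xg∉Δ))) x∈Δ))

  Intersect-sym : ∀ {Δ : Subset n} {π τ : Tab n} → Intersect Δ π τ → Intersect Δ τ π
  Intersect-sym (x , x∈Δ , xπ≡xτ) = x , x∈Δ , sym xπ≡xτ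

  Intersect-⊙ʳ : ∀ {Δ : Subset n} {u u′ : Tab n} g → Intersect Δ u u′ → Intersect Δ (u ⊙ g) (u′ ⊙ g)
  Intersect-⊙ʳ {u = u} {u′} g (x , x∈Δ , xu≡xu′) = x , x∈Δ , (begin
    x ^ (u ⊙ g)   ≡⟨ ^-⊙ x u g ⟩
    (x ^ u) ^ g   ≡⟨ cong (_^ g) xu≡xu′ ⟩
    (x ^ u′) ^ g  ≡⟨ ^-⊙ x u′ g ⟨
    x ^ (u′ ⊙ g)  ∎)
    where open ≡-Reasoning

  intersect? : ∀ (Δ : Subset n) π τ → Dec (Intersect Δ π τ)
  intersect? Δ π τ = any? (λ x → (x ∈? Δ) ×-dec (x ^ π ≟F x ^ τ))

  intersects : Subset n → Tab n → Tab n → Bool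
  intersects Δ π τ = isYes (intersect? Δ π τ)

  intersects⁺ : ∀ {Δ : Subset n} {π τ} → Intersect Δ π τ → T (intersects Δ π τ)
  intersects⁺ {Δ} {π} {τ} = fromWitness {a? = intersect? Δ π τ}

  intersects⁻ : ∀ {Δ : Subset n} {π τ} → T (intersects Δ π τ) → Intersect Δ π τ
  intersects⁻ {Δ} {π} {τ} = toWitness {a? = intersect? Δ π τ}

  intersects-sym : ∀ {Δ : Subset n} {π τ} → T (intersects Δ π τ) → T (intersects Δ τ π)
  intersects-sym {Δ} {π} {τ} = intersects⁺ {Δ} {τ} {π} ∘ Intersect-sym {Δ = Δ} {π} {τ} ∘ intersects⁻ {Δ} {π} {τ}

  fixes : Fin n → Tab n → Bool
  fixes x g = isYes (x ^ g ≟F x)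

  fixes⁺ : ∀ {x : Fin n} {g} → x ^ g ≡ x → T (fixes x g)
  fixes⁺ {x} {g} = fromWitness {a? = x ^ g ≟F x}

  fixes⁻ : ∀ {x : Fin n} {g} → T (fixes x g) → x ^ g ≡ x
  fixes⁻ {x} {g} = toWitness {a? = x ^ g ≟F x}

  elements : List (Tab n) → List (Tab n)
  elements = deduplicate _≟T_

  elements-unique : ∀ G → Unique (elements G)
  elements-unique = DecUnique.deduplicate-! _≟T_

  ∈-elements⁺ : ∀ {G g} → g ∈ₗ G → g ∈ₗ elements G
  ∈-elements⁺ = ∈-deduplicate⁺ _≟T_

  ∈-elements⁻ : ∀ {G g} → g ∈ₗ elements G → g ∈ₗ G
  ∈-elements⁻ {G} = ∈-deduplicate⁻ _≟T_ G

  stabSize≡count : ∀ G (x : Fin n) → stabSize G x ≡ count (fixes x) (elements G)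
  stabSize≡count G x = trans
    (≤-antisym (⊆⇒length≤ _≟T_ (elements-unique (filter fix? G)) stab⊆)
               (⊆⇒length≤ _≟T_ (Unique.filter⁺ (T? ∘ fixes x) (elements-unique G)) ⊆stab))
    (length-filterᵇ (fixes x) (elements G))
    where
    fix? : ∀ g → Dec (x ^ g ≡ x)
    fix? g = x ^ g ≟F x
    stab⊆ : ∀ {g} → g ∈ₗ elements (filter fix? G) → g ∈ₗ filterᵇ (fixes x) (elements G)
    stab⊆ {g} g∈ with ∈-filter⁻ fix? {xs = G} (∈-elements⁻ {filter fix? G} g∈)
    ... | g∈G , xg≡x = ∈-filter⁺ (T? ∘ fixes x) (∈-elements⁺ g∈G) (fixes⁺ {x} {g} xg≡x)
    ⊆stab : ∀ {g} → g ∈ₗ filterᵇ (fixes x) (elements G) → g ∈ₗ elements (filter fix? G)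
    ⊆stab {g} g∈ with ∈-filter⁻ (T? ∘ fixes x) {xs = elements G} g∈
    ... | g∈G , xg≡x = ∈-elements⁺ (∈-filter⁺ fix? (∈-elements⁻ {G} g∈G) (fixes⁻ {x} {g} xg≡x))

module _ (f : A → ℕ) where

  ≤-foldr-⊔ : ∀ {x} xs → x ∈ₗ xs → f x ≤ foldr _⊔_ 0 (map f xs)
  ≤-foldr-⊔ (y ∷ xs) (here refl) = m≤m⊔n (f y) _
  ≤-foldr-⊔ (y ∷ xs) (there x∈) = m≤n⇒m≤o⊔n (f y) (≤-foldr-⊔ xs x∈)

  foldr-⊔-attained : ∀ xs → foldr _⊔_ 0 (map f xs) ≡ 0 ⊎ ∃ λ x → x ∈ₗ xs × foldr _⊔_ 0 (map f xs) ≡ f x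
  foldr-⊔-attained []       = inj₁ refl
  foldr-⊔-attained (y ∷ xs) with ⊔-sel (f y) (foldr _⊔_ 0 (map f xs)) | foldr-⊔-attained xs
  ... | inj₁ max≡fy | _                      = inj₂ (y , here refl , max≡fy)
  ... | inj₂ max≡ih | inj₁ ih≡0              = inj₁ (trans max≡ih ih≡0)
  ... | inj₂ max≡ih | inj₂ (x , x∈xs , ih≡fx) = inj₂ (x , there x∈xs , trans max≡ih ih≡fx)

module _ {n : ℕ} (Δ : Subset n) (G : List (Tab n)) where

  private
    stabSizeOn : Fin n → ℕ
    stabSizeOn x = if lookup Δ x then stabSize G x else 0

  stabSize≤maxStab : ∀ {x} → x ∈ Δ → stabSize G x ≤ maxStab Δ G
  stabSize≤maxStab {x} x∈Δ = subst (λ b → (if b then stabSize G x else 0) ≤ maxStab Δ G) ([]=⇒lookup x∈Δ)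
    (≤-foldr-⊔ stabSizeOn (allFin n) (∈-allFin x))

  maxStab-attained : maxStab Δ G ≡ 0 ⊎ ∃ λ x → x ∈ Δ × maxStab Δ G ≡ stabSize G x
  maxStab-attained with foldr-⊔-attained stabSizeOn (allFin n)
  ... | inj₁ max≡0 = inj₁ max≡0
  ... | inj₂ (x , _ , max≡) with lookup Δ x in x∈Δ
  ... | true  = inj₂ (x , lookup⇒[]= x Δ x∈Δ , max≡)
  ... | false = inj₁ max≡

module PermGroup {n : ℕ} {Δ : Subset n} {G : List (Tab n)} (G-group : IsPermGroupOn Δ G) where

  open IsPermGroupOn G-group

  U : List (Tab n)
  U = elements G

  perm∈ : ∀ {g} → g ∈ₗ U → IsPerm g
  perm∈ = All.lookup perm ∘ ∈-elements⁻

  closed∈ : ∀ {g h} → g ∈ₗ U → h ∈ₗ U → g ⊙ h ∈ₗ U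
  closed∈ g∈U h∈U = ∈-elements⁺ (closed (∈-elements⁻ g∈U) (∈-elements⁻ h∈U))

  -- U ⊙ g ⊆ U and both lists have the same length, so U ⊙ g exhausts U and contains idT.
  inverseˡ : ∀ {g} → g ∈ₗ U → ∃ λ h → h ∈ₗ U × h ⊙ g ≡ idT
  inverseˡ {g} g∈U = let h , h∈U , idT≡h⊙g = ∈-map⁻ (_⊙ g) idT∈U⊙g in h , h∈U , sym idT≡h⊙g
    where
    U⊙g! : Unique (map (_⊙ g) U)
    U⊙g! = Unique.map⁺ (⊙-cancelʳ {g = g} (perm∈ g∈U)) (elements-unique G)
    U⊙g⊆U : ∀ {w} → w ∈ₗ map (_⊙ g) U → w ∈ₗ U
    U⊙g⊆U w∈ with ∈-map⁻ (_⊙ g) w∈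
    ... | u , u∈U , refl = closed∈ u∈U g∈U
    idT∈U⊙g : idT ∈ₗ map (_⊙ g) U
    idT∈U⊙g = ⊆∧length≥⇒⊇ _≟T_ U⊙g! U⊙g⊆U (≤-reflexive (sym (length-map (_⊙ g) U))) (∈-elements⁺ hasId)

  ⊙-cancelˡ : ∀ {u} → u ∈ₗ U → ∀ {g g′} → u ⊙ g ≡ u ⊙ g′ → g ≡ g′
  ⊙-cancelˡ {u} u∈U {g} {g′} ug≡ug′ with inverseˡ u∈U
  ... | h , _ , h⊙u≡id = trans (sym (h⊙[u⊙k]≡k g)) (trans (cong (h ⊙_) ug≡ug′) (h⊙[u⊙k]≡k g′))
    where
    h⊙[u⊙k]≡k : ∀ k → h ⊙ (u ⊙ k) ≡ k
    h⊙[u⊙k]≡k k = trans (sym (⊙-assoc h u k)) (trans (cong (_⊙ k) h⊙u≡id) (⊙-identityˡ k))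

  _·ʳ_ : (Tab n → Bool) → Tab n → Tab n → Bool
  (X ·ʳ g) w = any (λ u → X u ∧ isYes ((u ⊙ g) ≟T w)) U

  ·ʳ⁺ : ∀ {X g u} → u ∈ₗ U → T (X u) → T ((X ·ʳ g) (u ⊙ g))
  ·ʳ⁺ {X} {g} {u} u∈U Xu = any-intro _ u∈U (from T-∧ (Xu , fromWitness {a? = (u ⊙ g) ≟T (u ⊙ g)} refl))

  ·ʳ⁻ : ∀ {X g w} → T ((X ·ʳ g) w) → ∃ λ u → u ∈ₗ U × T (X u) × u ⊙ g ≡ w
  ·ʳ⁻ {X} {g} {w} Xg[w] with any-witness _ U Xg[w]
  ... | u , u∈U , Xu∧ug≡w = let Xu , ug≡w = to (T-∧ {X u}) Xu∧ug≡w in u , u∈U , Xu , toWitness ug≡w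

  ·ʳ-mono : ∀ {X Y g w} → (∀ {u} → T (X u) → T (Y u)) → T ((X ·ʳ g) w) → T ((Y ·ʳ g) w)
  ·ʳ-mono {X} {Y} {g} X⊆Y X·g[w] with ·ʳ⁻ {X} {g} X·g[w]
  ... | u , u∈U , Xu , refl = ·ʳ⁺ {Y} {g} u∈U (X⊆Y Xu)

module _ {n : ℕ} {Δ : Subset n} {G : List (Tab n)} (G-group : IsPermGroupOn Δ G) (G-ekr : HasEKR Δ G) where

  open PermGroup G-group

  private
    α : ℕ
    α = maxStab Δ G

    meets : Tab n → Tab n → Bool
    meets = intersects Δ

  count≤maxStab : ∀ (P : Tab n → Bool) → (∀ {π τ} → π ∈ₗ U → τ ∈ₗ U → T (P π) → T (P τ) → Intersect Δ π τ) →
                  count P U ≤ α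
  count≤maxStab P P-intersecting = subst (_≤ α) (length-filterᵇ P U)
    (G-ekr (filterᵇ P U) (Unique.filter⁺ (T? ∘ P) (elements-unique G))
           (All.tabulate (∈-elements⁻ ∘ proj₁ ∘ ∈-filter⁻ (T? ∘ P)))
           (λ π∈ τ∈ → let π∈U , Pπ = ∈-filter⁻ (T? ∘ P) π∈
                          τ∈U , Pτ = ∈-filter⁻ (T? ∘ P) τ∈
                      in P-intersecting π∈U τ∈U Pπ Pτ))

  module _ (X : Tab n → Bool) (X-intersecting : Intersecting meets U X) where

    private
      N : Tab n → Bool
      N = closedNbhd meets U X

    -- If πg⁻¹ met no member of X it would lie in N, i.e. π would lie in N·g.
    outside-N·g-meets-X·g : ∀ {g π τ} → g ∈ₗ U → π ∈ₗ U → ¬ T ((N ·ʳ g) π) → T ((X ·ʳ g) τ) → Intersect Δ π τ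
    outside-N·g-meets-X·g {g} {π} {τ} g∈U π∈U π∉N·g Xg[τ] with intersect? Δ π τ | ·ʳ⁻ {X} {g} Xg[τ] | inverseˡ g∈U
    ... | yes π∩τ | _ | _ = π∩τ
    ... | no π∤τ | f , f∈U , Xf , refl | h , h∈U , h⊙g≡id = ⊥-elim (π∉N·g (subst (T ∘ (N ·ʳ g)) πh⊙g≡π N·g[πh⊙g]))
      where
      πh⊙g≡π : (π ⊙ h) ⊙ g ≡ π
      πh⊙g≡π = trans (⊙-assoc π h g) (trans (cong (π ⊙_) h⊙g≡id) (⊙-identityʳ π))
      πh∤f : ¬ T (meets (π ⊙ h) f)
      πh∤f πh∩f = π∤τ (subst (λ σ → Intersect Δ σ (f ⊙ g)) πh⊙g≡π (Intersect-⊙ʳ {u = π ⊙ h} {f} g (intersects⁻ {Δ = Δ} {π ⊙ h} {f} πh∩f)))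
      N·g[πh⊙g] : T ((N ·ʳ g) ((π ⊙ h) ⊙ g))
      N·g[πh⊙g] = ·ʳ⁺ {N} {g} (closed∈ π∈U h∈U) (closedNbhd⁺ʳ meets U f∈U Xf πh∤f)

    module _ {x₀ : Fin n} (x₀∈Δ : x₀ ∈ Δ) (α≡|Stab| : α ≡ count (fixes x₀) U) where

      private
        Stab : Tab n → Bool
        Stab = fixes x₀

        K : Tab n → Tab n → Bool
        K g w = (Stab w ∧ not ((N ·ʳ g) w)) ∨ (X ·ʳ g) w

        K⁻ : ∀ {g w} → T (K g w) → (T (Stab w) × ¬ T ((N ·ʳ g) w)) ⊎ T ((X ·ʳ g) w)
        K⁻ {g} {w} Kw with to (T-∨ {Stab w ∧ not ((N ·ʳ g) w)}) Kw
        ... | inj₁ Stab∖N·g = let Stab-w , ¬N·g = to (T-∧ {Stab w}) Stab∖N·g in inj₁ (Stab-w , T-not⁻ ¬N·g)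
        ... | inj₂ X·g       = inj₂ X·g

      K-intersecting : ∀ {g π τ} → g ∈ₗ U → π ∈ₗ U → τ ∈ₗ U → T (K g π) → T (K g τ) → Intersect Δ π τ
      K-intersecting {g} {π} {τ} g∈U π∈U τ∈U Kπ Kτ with K⁻ {g} {π} Kπ | K⁻ {g} {τ} Kτ
      ... | inj₁ (Stab-π , _) | inj₁ (Stab-τ , _) = x₀ , x₀∈Δ , trans (fixes⁻ {x = x₀} {π} Stab-π) (sym (fixes⁻ {x = x₀} {τ} Stab-τ))
      ... | inj₁ (_ , π∉N·g) | inj₂ X·g[τ] = outside-N·g-meets-X·g g∈U π∈U π∉N·g X·g[τ]
      ... | inj₂ X·g[π] | inj₁ (_ , τ∉N·g) = Intersect-sym {Δ = Δ} {τ} {π} (outside-N·g-meets-X·g g∈U τ∈U τ∉N·g X·g[π])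
      ... | inj₂ X·g[π] | inj₂ X·g[τ] with ·ʳ⁻ {X} {g} X·g[π] | ·ʳ⁻ {X} {g} X·g[τ]
      ... | f , f∈U , Xf , refl | f′ , f′∈U , Xf′ , refl =
        Intersect-⊙ʳ {u = f} {f′} g (intersects⁻ {Δ = Δ} {f} {f′} (X-intersecting f∈U f′∈U Xf Xf′))

      count-X≤count-X·g : ∀ {g} → g ∈ₗ U → count X U ≤ count (X ·ʳ g) U
      count-X≤count-X·g {g} g∈U = count-≤-injection _≟T_ (_⊙ g) (elements-unique G) (⊙-cancelʳ {g = g} (perm∈ g∈U))
        (λ {u} u∈U Xu → closed∈ u∈U g∈U , ·ʳ⁺ {X} {g} u∈U Xu)

      count-X≤count-Stab∩N·g : ∀ {g} → g ∈ₗ U → count X U ≤ count (λ w → Stab w ∧ (N ·ʳ g) w) U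
      count-X≤count-Stab∩N·g {g} g∈U = +-cancelʳ-≤ |Stab∖N·g| _ _ (begin
        count X U + |Stab∖N·g|                            ≤⟨ +-monoˡ-≤ |Stab∖N·g| (count-X≤count-X·g g∈U) ⟩
        count (X ·ʳ g) U + |Stab∖N·g|                     ≡⟨ +-comm _ |Stab∖N·g| ⟩
        |Stab∖N·g| + count (X ·ʳ g) U                     ≡⟨ count-∨ _ _ U Stab∖N·g∩X·g≡∅ ⟩
        count (K g) U                                     ≤⟨ count≤maxStab (K g) (K-intersecting g∈U) ⟩
        α                                                 ≡⟨ α≡|Stab| ⟩
        count Stab U                                      ≡⟨ count-∧-split Stab (N ·ʳ g) U ⟩
        count (λ w → Stab w ∧ (N ·ʳ g) w) U + |Stab∖N·g|  ∎)
        where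
        open ≤-Reasoning
        |Stab∖N·g| : ℕ
        |Stab∖N·g| = count (λ w → Stab w ∧ not ((N ·ʳ g) w)) U
        Stab∖N·g∩X·g≡∅ : ∀ {w} → w ∈ₗ U → T (Stab w ∧ not ((N ·ʳ g) w)) → T ((X ·ʳ g) w) → ⊥
        Stab∖N·g∩X·g≡∅ {w} _ Stab∖N·g[w] X·g[w] =
          T-not⁻ (proj₂ (to (T-∧ {Stab w}) Stab∖N·g[w])) (·ʳ-mono {X} {N} {g} (closedNbhd⁺ˡ meets U) X·g[w])

      count-Stab∩N·g≤ : ∀ {g} → count (λ w → Stab w ∧ (N ·ʳ g) w) U ≤ count (λ u → N u ∧ Stab (u ⊙ g)) U
      count-Stab∩N·g≤ {g} = count-≤-surjection _≟T_ (_⊙ g) (elements-unique G) onto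
        where
        onto : ∀ {w} → w ∈ₗ U → T (Stab w ∧ (N ·ʳ g) w) → ∃ λ u → u ∈ₗ U × T (N u ∧ Stab (u ⊙ g)) × u ⊙ g ≡ w
        onto {w} _ Stab∩N·g[w] with to (T-∧ {Stab w}) Stab∩N·g[w]
        ... | Stab-w , N·g[w] with ·ʳ⁻ {N} {g} N·g[w]
        ... | u , u∈U , Nu , refl = u , u∈U , from T-∧ (Nu , Stab-w) , refl

      count-Stab[u⊙_]≤α : ∀ {u} → u ∈ₗ U → count (λ g → Stab (u ⊙ g)) U ≤ α
      count-Stab[u⊙_]≤α {u} u∈U = subst (count (λ g → Stab (u ⊙ g)) U ≤_) (sym α≡|Stab|)
        (count-≤-injection _≟T_ (u ⊙_) (elements-unique G) (⊙-cancelˡ u∈U) (λ g∈U Stab-ug → closed∈ u∈U g∈U , Stab-ug))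

      neighbourhoodBound-at : count X U * length U ≤ α * count N U
      neighbourhoodBound-at = begin
        count X U * length U                                   ≡⟨ *-comm (count X U) (length U) ⟩
        length U * count X U                                   ≡⟨ ∑-const (count X U) U ⟨
        ∑[ g ← U ] count X U                                   ≤⟨ ∑-mono-≤ U (λ {g} g∈U → ≤-trans (count-X≤count-Stab∩N·g g∈U) (count-Stab∩N·g≤ {g})) ⟩
        ∑[ g ← U ] ∑[ u ← U ] 𝟙 (N u ∧ Stab (u ⊙ g))           ≡⟨ ∑-comm (λ g u → 𝟙 (N u ∧ Stab (u ⊙ g))) U U ⟩
        ∑[ u ← U ] ∑[ g ← U ] 𝟙 (N u ∧ Stab (u ⊙ g))           ≤⟨ ∑-mono-≤ U per-u ⟩
        ∑[ u ← U ] (𝟙 (N u) * α)                               ≡⟨ ∑-*ʳ α (𝟙 ∘ N) U ⟩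
        count N U * α                                          ≡⟨ *-comm (count N U) α ⟩
        α * count N U                                          ∎
        where
        open ≤-Reasoning
        per-u : ∀ {u} → u ∈ₗ U → ∑[ g ← U ] 𝟙 (N u ∧ Stab (u ⊙ g)) ≤ 𝟙 (N u) * α
        per-u {u} u∈U with N u
        ... | true  = subst (count (λ g → Stab (u ⊙ g)) U ≤_) (sym (+-identityʳ α)) (count-Stab[u⊙_]≤α u∈U)
        ... | false = ≤-reflexive (trans (∑-const 0 U) (*-zeroʳ (length U)))

  neighbourhoodBound : NeighbourhoodBound meets U α
  neighbourhoodBound X X-intersecting with maxStab-attained Δ G
  ... | inj₁ α≡0 = subst (_≤ α * count (closedNbhd meets U X) U) (sym (cong (_* length U) |X|≡0)) z≤n
    where
    |X|≡0 : count X U ≡ 0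
    |X|≡0 = n≤0⇒n≡0 (subst (count X U ≤_) α≡0 (count≤maxStab X λ {π} {τ} π∈U τ∈U Xπ Xτ →
              intersects⁻ {Δ = Δ} {π} {τ} (X-intersecting π∈U τ∈U Xπ Xτ)))
  ... | inj₂ (x₀ , x₀∈Δ , α≡stab) = neighbourhoodBound-at X X-intersecting x₀∈Δ (trans α≡stab (stabSize≡count G x₀))

module DirectProduct {n : ℕ} {Δ₁ Δ₂ : Subset n} {G₁ G₂ : List (Tab n)}
  (G₁-group : IsPermGroupOn Δ₁ G₁) (G₂-group : IsPermGroupOn Δ₂ G₂)
  (Δ₁∩Δ₂≡∅ : ∀ x → x ∈ Δ₁ → x ∈ Δ₂ → ⊥) where

  open IsPermGroupOn G₁-group renaming (perm to perm₁; support to support₁; hasId to hasId₁; closed to closed₁)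
  open IsPermGroupOn G₂-group renaming (perm to perm₂; support to support₂; hasId to hasId₂; closed to closed₂)

  Δ : Subset n
  Δ = Δ₁ ∪ Δ₂

  G₁G₂ : List (Tab n)
  G₁G₂ = cartesianProductWith _⊙_ G₁ G₂

  Δ₂⊆∁Δ₁ : ∀ {x} → x ∈ Δ₂ → x ∉ Δ₁
  Δ₂⊆∁Δ₁ x∈Δ₂ x∈Δ₁ = Δ₁∩Δ₂≡∅ _ x∈Δ₁ x∈Δ₂

  ^-⊙-on-Δ₁ : ∀ {g h} → g ∈ₗ G₁ → h ∈ₗ G₂ → ∀ {x} → x ∈ Δ₁ → x ^ (g ⊙ h) ≡ x ^ g
  ^-⊙-on-Δ₁ {g} {h} g∈G₁ h∈G₂ {x} x∈Δ₁ = trans (^-⊙ x g h)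
    (support₂ h∈G₂ (x ^ g) (Δ₁∩Δ₂≡∅ _ (support-closed {g = g} (All.lookup perm₁ g∈G₁) (support₁ g∈G₁) x∈Δ₁)))

  ^-⊙-off-Δ₁ : ∀ {g} h → g ∈ₗ G₁ → ∀ {x} → x ∉ Δ₁ → x ^ (g ⊙ h) ≡ x ^ h
  ^-⊙-off-Δ₁ {g} h g∈G₁ {x} x∉Δ₁ = trans (^-⊙ x g h) (cong (_^ h) (support₁ g∈G₁ x x∉Δ₁))

  ^-off-Δ₁ : ∀ {h} → h ∈ₗ G₂ → ∀ {x} → x ∉ Δ₁ → x ^ h ∉ Δ₁
  ^-off-Δ₁ {h} h∈G₂ {x} x∉Δ₁ with x ∈? Δ₂
  ... | yes x∈Δ₂ = Δ₂⊆∁Δ₁ (support-closed {g = h} (All.lookup perm₂ h∈G₂) (support₂ h∈G₂) x∈Δ₂)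
  ... | no  x∉Δ₂ = subst (_∉ Δ₁) (sym (support₂ h∈G₂ x x∉Δ₂)) x∉Δ₁

  ⊙-comm : ∀ {g h} → g ∈ₗ G₁ → h ∈ₗ G₂ → g ⊙ h ≡ h ⊙ g
  ⊙-comm {g} {h} g∈G₁ h∈G₂ = Tab-ext λ x → trans (x^gh x) (sym (^-⊙ x h g))
    where
    x^gh : ∀ x → x ^ (g ⊙ h) ≡ (x ^ h) ^ g
    x^gh x with x ∈? Δ₁
    ... | yes x∈Δ₁ = trans (^-⊙-on-Δ₁ g∈G₁ h∈G₂ x∈Δ₁) (cong (_^ g) (sym (support₂ h∈G₂ x (Δ₁∩Δ₂≡∅ x x∈Δ₁))))
    ... | no  x∉Δ₁ = trans (^-⊙-off-Δ₁ h g∈G₁ x∉Δ₁) (sym (support₁ g∈G₁ (x ^ h) (^-off-Δ₁ h∈G₂ x∉Δ₁)))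

  ⊙-interchange : ∀ {g g′ h h′} → g′ ∈ₗ G₁ → h ∈ₗ G₂ → (g ⊙ h) ⊙ (g′ ⊙ h′) ≡ (g ⊙ g′) ⊙ (h ⊙ h′)
  ⊙-interchange {g} {g′} {h} {h′} g′∈G₁ h∈G₂ = begin
    (g ⊙ h) ⊙ (g′ ⊙ h′)  ≡⟨ ⊙-assoc g h (g′ ⊙ h′) ⟩
    g ⊙ (h ⊙ (g′ ⊙ h′))  ≡⟨ cong (g ⊙_) (⊙-assoc h g′ h′) ⟨
    g ⊙ ((h ⊙ g′) ⊙ h′)  ≡⟨ cong (λ k → g ⊙ (k ⊙ h′)) (⊙-comm g′∈G₁ h∈G₂) ⟨
    g ⊙ ((g′ ⊙ h) ⊙ h′)  ≡⟨ cong (g ⊙_) (⊙-assoc g′ h h′) ⟩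
    g ⊙ (g′ ⊙ (h ⊙ h′))  ≡⟨ ⊙-assoc g g′ (h ⊙ h′) ⟨
    (g ⊙ g′) ⊙ (h ⊙ h′)  ∎
    where open ≡-Reasoning

  G₁G₂-group : IsPermGroupOn Δ G₁G₂
  G₁G₂-group = record
    { perm    = All.tabulate perm∈
    ; support = support∈
    ; hasId   = subst (_∈ₗ G₁G₂) (⊙-identityˡ idT) (∈-cartesianProductWith⁺ _⊙_ hasId₁ hasId₂)
    ; closed  = closed∈
    }
    where
    perm∈ : ∀ {π} → π ∈ₗ G₁G₂ → IsPerm π
    perm∈ π∈ with ∈-cartesianProductWith⁻ _⊙_ G₁ G₂ π∈
    ... | g , h , g∈G₁ , h∈G₂ , refl = IsPerm-⊙ {g = g} {h} (All.lookup perm₁ g∈G₁) (All.lookup perm₂ h∈G₂)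
    support∈ : ∀ {π} → π ∈ₗ G₁G₂ → ∀ x → x ∉ Δ → x ^ π ≡ x
    support∈ π∈ x x∉Δ with ∈-cartesianProductWith⁻ _⊙_ G₁ G₂ π∈
    ... | g , h , g∈G₁ , h∈G₂ , refl =
      trans (^-⊙-off-Δ₁ h g∈G₁ (x∉Δ ∘ x∈p∪q⁺ ∘ inj₁)) (support₂ h∈G₂ x (x∉Δ ∘ x∈p∪q⁺ ∘ inj₂))
    closed∈ : ∀ {π τ} → π ∈ₗ G₁G₂ → τ ∈ₗ G₁G₂ → π ⊙ τ ∈ₗ G₁G₂
    closed∈ π∈ τ∈ with ∈-cartesianProductWith⁻ _⊙_ G₁ G₂ π∈ | ∈-cartesianProductWith⁻ _⊙_ G₁ G₂ τ∈
    ... | g , h , g∈G₁ , h∈G₂ , refl | g′ , h′ , g′∈G₁ , h′∈G₂ , refl =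
      subst (_∈ₗ G₁G₂) (sym (⊙-interchange {g} {g′} {h} {h′} g′∈G₁ h∈G₂))
            (∈-cartesianProductWith⁺ _⊙_ (closed₁ g∈G₁ g′∈G₁) (closed₂ h∈G₂ h′∈G₂))

  Intersect-split : ∀ {u u′ v v′} → u ∈ₗ G₁ → u′ ∈ₗ G₁ → v ∈ₗ G₂ → v′ ∈ₗ G₂ →
                    Intersect Δ (u ⊙ v) (u′ ⊙ v′) → Intersect Δ₁ u u′ ⊎ Intersect Δ₂ v v′
  Intersect-split {u} {u′} {v} {v′} u∈ u′∈ v∈ v′∈ (x , x∈Δ , x^uv≡x^u′v′) with x∈p∪q⁻ Δ₁ Δ₂ x∈Δ
  ... | inj₁ x∈Δ₁ = inj₁ (x , x∈Δ₁ , trans (sym (^-⊙-on-Δ₁ u∈ v∈ x∈Δ₁)) (trans x^uv≡x^u′v′ (^-⊙-on-Δ₁ u′∈ v′∈ x∈Δ₁)))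
  ... | inj₂ x∈Δ₂ = inj₂ (x , x∈Δ₂ , trans (sym (^-⊙-off-Δ₁ v u∈ (Δ₂⊆∁Δ₁ x∈Δ₂)))
                                       (trans x^uv≡x^u′v′ (^-⊙-off-Δ₁ v′ u′∈ (Δ₂⊆∁Δ₁ x∈Δ₂))))

  ⊙-injective : ∀ {u u′ v v′} → u ∈ₗ G₁ → u′ ∈ₗ G₁ → v ∈ₗ G₂ → v′ ∈ₗ G₂ → u ⊙ v ≡ u′ ⊙ v′ → u ≡ u′ × v ≡ v′
  ⊙-injective {u} {u′} {v} {v′} u∈ u′∈ v∈ v′∈ uv≡u′v′ = Tab-ext x^u≡x^u′ , Tab-ext x^v≡x^v′
    where
    x^u≡x^u′ : ∀ x → x ^ u ≡ x ^ u′
    x^u≡x^u′ x with x ∈? Δ₁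
    ... | yes x∈Δ₁ = trans (sym (^-⊙-on-Δ₁ u∈ v∈ x∈Δ₁)) (trans (cong (x ^_) uv≡u′v′) (^-⊙-on-Δ₁ u′∈ v′∈ x∈Δ₁))
    ... | no  x∉Δ₁ = trans (support₁ u∈ x x∉Δ₁) (sym (support₁ u′∈ x x∉Δ₁))
    x^v≡x^v′ : ∀ x → x ^ v ≡ x ^ v′
    x^v≡x^v′ x with x ∈? Δ₂
    ... | yes x∈Δ₂ = trans (sym (^-⊙-off-Δ₁ v u∈ (Δ₂⊆∁Δ₁ x∈Δ₂)))
                           (trans (cong (x ^_) uv≡u′v′) (^-⊙-off-Δ₁ v′ u′∈ (Δ₂⊆∁Δ₁ x∈Δ₂)))
    ... | no  x∉Δ₂ = trans (support₂ v∈ x x∉Δ₂) (sym (support₂ v′∈ x x∉Δ₂))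

  module _ (G₁-ekr : HasEKR Δ₁ G₁) (G₂-ekr : HasEKR Δ₂ G₂) where

    private
      U₁ U₂ : List (Tab n)
      U₁ = elements G₁
      U₂ = elements G₂
      α₁ α₂ : ℕ
      α₁ = maxStab Δ₁ G₁
      α₂ = maxStab Δ₂ G₂

      ⊙-into-G₁G₂ : ∀ {g h} → g ∈ₗ U₁ → h ∈ₗ U₂ → g ⊙ h ∈ₗ elements G₁G₂
      ⊙-into-G₁G₂ g∈ h∈ = ∈-elements⁺ (∈-cartesianProductWith⁺ _⊙_ (∈-elements⁻ g∈) (∈-elements⁻ h∈))

      ⊙-injective-U : ∀ {u u′ v v′} → u ∈ₗ U₁ → u′ ∈ₗ U₁ → v ∈ₗ U₂ → v′ ∈ₗ U₂ → u ⊙ v ≡ u′ ⊙ v′ → u ≡ u′ × v ≡ v′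
      ⊙-injective-U u∈ u′∈ v∈ v′∈ = ⊙-injective (∈-elements⁻ u∈) (∈-elements⁻ u′∈) (∈-elements⁻ v∈) (∈-elements⁻ v′∈)

      count-fixes≤maxStab : ∀ {x} → x ∈ Δ → count (fixes x) (elements G₁G₂) ≤ maxStab Δ G₁G₂
      count-fixes≤maxStab {x} x∈Δ = subst (_≤ maxStab Δ G₁G₂) (stabSize≡count G₁G₂ x) (stabSize≤maxStab Δ G₁G₂ x∈Δ)

    -- The stabiliser of x₀ ∈ Δ₁ in G₁G₂ contains (G₁)ₓ₀ · G₂.
    α₁*|G₂|≤maxStab : α₁ * length U₂ ≤ maxStab Δ G₁G₂
    α₁*|G₂|≤maxStab with maxStab-attained Δ₁ G₁
    ... | inj₁ α₁≡0 = subst (λ α → α * length U₂ ≤ maxStab Δ G₁G₂) (sym α₁≡0) z≤n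
    ... | inj₂ (x₀ , x₀∈Δ₁ , α₁≡stab) = begin
      α₁ * length U₂                                  ≡⟨ cong₂ _*_ (trans α₁≡stab (stabSize≡count G₁ x₀)) (sym (count-true U₂)) ⟩
      count (fixes x₀) U₁ * count (λ _ → true) U₂     ≤⟨ count-product≤ _≟T_ _⊙_ (elements-unique G₁) (elements-unique G₂) ⊙-injective-U into ⟩
      count (fixes x₀) (elements G₁G₂)                ≤⟨ count-fixes≤maxStab (x∈p∪q⁺ (inj₁ x₀∈Δ₁)) ⟩
      maxStab Δ G₁G₂                                  ∎
      where
      open ≤-Reasoning
      into : ∀ {g h} → g ∈ₗ U₁ → h ∈ₗ U₂ → T (fixes x₀ g) → T true → g ⊙ h ∈ₗ elements G₁G₂ × T (fixes x₀ (g ⊙ h))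
      into {g} {h} g∈ h∈ x₀g≡x₀ _ = ⊙-into-G₁G₂ g∈ h∈ ,
        fixes⁺ {x = x₀} {g ⊙ h} (trans (^-⊙-on-Δ₁ (∈-elements⁻ g∈) (∈-elements⁻ h∈) x₀∈Δ₁) (fixes⁻ {x = x₀} {g} x₀g≡x₀))

    α₂*|G₁|≤maxStab : α₂ * length U₁ ≤ maxStab Δ G₁G₂
    α₂*|G₁|≤maxStab with maxStab-attained Δ₂ G₂
    ... | inj₁ α₂≡0 = subst (λ α → α * length U₁ ≤ maxStab Δ G₁G₂) (sym α₂≡0) z≤n
    ... | inj₂ (y₀ , y₀∈Δ₂ , α₂≡stab) = begin
      α₂ * length U₁                                  ≡⟨ *-comm α₂ _ ⟩
      length U₁ * α₂                                  ≡⟨ cong₂ _*_ (sym (count-true U₁)) (trans α₂≡stab (stabSize≡count G₂ y₀)) ⟩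
      count (λ _ → true) U₁ * count (fixes y₀) U₂     ≤⟨ count-product≤ _≟T_ _⊙_ (elements-unique G₁) (elements-unique G₂) ⊙-injective-U into ⟩
      count (fixes y₀) (elements G₁G₂)                ≤⟨ count-fixes≤maxStab (x∈p∪q⁺ (inj₂ y₀∈Δ₂)) ⟩
      maxStab Δ G₁G₂                                  ∎
      where
      open ≤-Reasoning
      into : ∀ {g h} → g ∈ₗ U₁ → h ∈ₗ U₂ → T true → T (fixes y₀ h) → g ⊙ h ∈ₗ elements G₁G₂ × T (fixes y₀ (g ⊙ h))
      into {g} {h} g∈ h∈ _ y₀h≡y₀ = ⊙-into-G₁G₂ g∈ h∈ ,
        fixes⁺ {x = y₀} {g ⊙ h} (trans (^-⊙-off-Δ₁ h (∈-elements⁻ g∈) (Δ₂⊆∁Δ₁ y₀∈Δ₂)) (fixes⁻ {x = y₀} {h} y₀h≡y₀))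

    module _ (S : List (Tab n)) (S! : Unique S) (S⊆G₁G₂ : All (_∈ₗ G₁G₂) S) (S-intersecting : IsIntersecting Δ S) where

      private
        open DecMembership (_≟T_ {n}) using () renaming (_∈?_ to _∈ₗ?_)

        I : Tab n → Tab n → Bool
        I u v = isYes ((u ⊙ v) ∈ₗ? S)

        size : ℕ
        size = ∑[ u ← U₁ ] count (I u) U₂

      |S|≤size : length S ≤ size
      |S|≤size = begin
        length S                                      ≡⟨ count-true S ⟨
        count (λ _ → true) S                          ≤⟨ count-≤-surjection _≟T_ (uncurry _⊙_) S! onto ⟩
        count (uncurry I) (cartesianProduct U₁ U₂)    ≡⟨ ∑-cartesianProductWith (λ uv → 𝟙 (uncurry I uv)) _,_ U₁ U₂ ⟩
        size                                          ∎
        where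
        open ≤-Reasoning
        onto : ∀ {π} → π ∈ₗ S → T true → ∃ λ uv → uv ∈ₗ cartesianProduct U₁ U₂ × T (uncurry I uv) × uncurry _⊙_ uv ≡ π
        onto π∈S _ with ∈-cartesianProductWith⁻ _⊙_ G₁ G₂ (All.lookup S⊆G₁G₂ π∈S)
        ... | u , v , u∈ , v∈ , refl =
          (u , v) , ∈-cartesianProductWith⁺ _,_ (∈-elements⁺ u∈) (∈-elements⁺ v∈) , fromWitness π∈S , refl

      I-intersecting : ∀ {u u′ v v′} → u ∈ₗ U₁ → u′ ∈ₗ U₁ → v ∈ₗ U₂ → v′ ∈ₗ U₂ → T (I u v) → T (I u′ v′) →
                       T (intersects Δ₁ u u′) ⊎ T (intersects Δ₂ v v′)
      I-intersecting {u} {u′} {v} {v′} u∈ u′∈ v∈ v′∈ Iuv Iu′v′ =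
        Sum.map (intersects⁺ {Δ = Δ₁} {u} {u′}) (intersects⁺ {Δ = Δ₂} {v} {v′})
          (Intersect-split (∈-elements⁻ u∈) (∈-elements⁻ u′∈) (∈-elements⁻ v∈) (∈-elements⁻ v′∈)
            (S-intersecting (toWitness Iuv) (toWitness Iu′v′)))

      size≤maxStab : size ≤ maxStab Δ G₁G₂
      size≤maxStab with α₂ * length U₁ ≤? α₁ * length U₂
      ... | yes α₂a≤α₁b = ≤-trans (P₁₂.size≤αA*b α₂a≤α₁b) α₁*|G₂|≤maxStab
        where
        module P₁₂ = ProductBound U₁ U₂ (intersects Δ₁) (intersects Δ₂)
                       (λ {π} {τ} → intersects-sym {Δ = Δ₁} {π} {τ}) (λ {π} {τ} → intersects-sym {Δ = Δ₂} {π} {τ})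
                       α₁ α₂ (neighbourhoodBound G₁-group G₁-ekr) (neighbourhoodBound G₂-group G₂-ekr) I I-intersecting
      ... | no  α₂a≰α₁b = begin
        size            ≡⟨ ∑-comm (λ u v → 𝟙 (I u v)) U₁ U₂ ⟩
        P₂₁.size        ≤⟨ P₂₁.size≤αA*b (<⇒≤ (≰⇒> α₂a≰α₁b)) ⟩
        α₂ * length U₁  ≤⟨ α₂*|G₁|≤maxStab ⟩
        maxStab Δ G₁G₂  ∎
        where
        open ≤-Reasoning
        module P₂₁ = ProductBound U₂ U₁ (intersects Δ₂) (intersects Δ₁)
                       (λ {π} {τ} → intersects-sym {Δ = Δ₂} {π} {τ}) (λ {π} {τ} → intersects-sym {Δ = Δ₁} {π} {τ})
                       α₂ α₁ (neighbourhoodBound G₂-group G₂-ekr) (neighbourhoodBound G₁-group G₁-ekr) (λ v u → I u v)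
                       (λ v∈ v′∈ u∈ u′∈ Iuv Iu′v′ → Sum.swap (I-intersecting u∈ u′∈ v∈ v′∈ Iuv Iu′v′))

    G₁G₂-ekr : HasEKR Δ G₁G₂
    G₁G₂-ekr S S! S⊆G₁G₂ S-intersecting =
      ≤-trans (|S|≤size S S! S⊆G₁G₂ S-intersecting) (size≤maxStab S S! S⊆G₁G₂ S-intersecting)

∈-⋃-map⁻ : ∀ {n} (f : A → Subset n) xs {x} → x ∈ ⋃ (map f xs) → ∃ λ a → x ∈ f a
∈-⋃-map⁻ f []       x∈ = ⊥-elim (∉⊥ x∈)
∈-⋃-map⁻ f (a ∷ as) x∈ with x∈p∪q⁻ (f a) (⋃ (map f as)) x∈
... | inj₁ x∈fa = a , x∈fa
... | inj₂ x∈⋃  = ∈-⋃-map⁻ f as x∈⋃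

unionΩ-suc : ∀ {n k} (Ω : Fin (suc k) → Subset n) → unionΩ Ω ≡ Ω zero ∪ unionΩ (Ω ∘ suc)
unionΩ-suc Ω = cong (λ Ωs → Ω zero ∪ ⋃ Ωs) (trans (map-tabulate suc Ω) (sym (map-tabulate id (Ω ∘ suc))))

concatMap≡cartesianProductWith : ∀ {n} (gs hs : List (Tab n)) →
  concatMap (λ g → map (g ⊙_) hs) gs ≡ cartesianProductWith _⊙_ gs hs
concatMap≡cartesianProductWith []       hs = refl
concatMap≡cartesianProductWith (g ∷ gs) hs = cong (map (g ⊙_) hs ++_) (concatMap≡cartesianProductWith gs hs)

trivialGroup : ∀ {n} → IsPermGroupOn (⋃ {n} []) (idT ∷ [])
trivialGroup = record
  { perm    = (λ x y x≡y → trans (sym (^-idT x)) (trans x≡y (^-idT y))) ∷ []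
  ; support = λ { (here refl) x _ → ^-idT x }
  ; hasId   = here refl
  ; closed  = λ { (here refl) (here refl) → here (⊙-identityʳ idT) }
  }

trivialGroup-ekr : ∀ {n} → HasEKR (⋃ {n} []) (idT ∷ [])
trivialGroup-ekr []      _ _ _            = z≤n
trivialGroup-ekr (π ∷ S) _ _ S-intersecting with S-intersecting (here refl) (here refl)
... | _ , x∈∅ , _ = ⊥-elim (∉⊥ x∈∅)

prodList-groupWithEKR : ∀ {n} k (Ω : Fin k → Subset n) (G : Fin k → List (Tab n)) →
  (∀ i j → i ≢ j → ∀ x → x ∈ Ω i → x ∈ Ω j → ⊥) →
  (∀ i → IsPermGroupOn (Ω i) (G i)) → (∀ i → HasEKR (Ω i) (G i)) →
  IsPermGroupOn (unionΩ Ω) (prodList G) × HasEKR (unionΩ Ω) (prodList G)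
prodList-groupWithEKR zero    Ω G _ _ _ = trivialGroup , trivialGroup-ekr
prodList-groupWithEKR (suc k) Ω G Ω-disjoint G-group G-ekr =
  subst₂ (λ Δ H → IsPermGroupOn Δ H × HasEKR Δ H)
    (sym (unionΩ-suc Ω)) (sym (concatMap≡cartesianProductWith (G zero) (prodList (G ∘ suc))))
    (G₁G₂-group , G₁G₂-ekr (G-ekr zero) (proj₂ rest))
  where
  rest : IsPermGroupOn (unionΩ (Ω ∘ suc)) (prodList (G ∘ suc)) × HasEKR (unionΩ (Ω ∘ suc)) (prodList (G ∘ suc))
  rest = prodList-groupWithEKR k (Ω ∘ suc) (G ∘ suc)
           (λ i j i≢j → Ω-disjoint (suc i) (suc j) (i≢j ∘ Fin-suc-injective)) (G-group ∘ suc) (G-ekr ∘ suc)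
  Ω₀∩rest≡∅ : ∀ x → x ∈ Ω zero → x ∈ unionΩ (Ω ∘ suc) → ⊥
  Ω₀∩rest≡∅ x x∈Ω₀ x∈rest with ∈-⋃-map⁻ (Ω ∘ suc) (allFin k) x∈rest
  ... | j , x∈Ωⱼ = Ω-disjoint zero (suc j) (λ ()) x x∈Ω₀ x∈Ωⱼ
  open DirectProduct (G-group zero) (proj₁ rest) Ω₀∩rest≡∅

theorem5p3 : (n k : ℕ) → 1 ≤ k → (Ω : Fin k → Subset n) → (G : Fin k → List (Tab n))
    → (∀ i → Nonempty (Ω i))
    → (∀ i j → i ≢ j → ∀ x → x ∈ Ω i → x ∈ Ω j → ⊥)
    → (∀ i → IsPermGroupOn (Ω i) (G i))
    → (∀ i → HasEKR (Ω i) (G i))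
    → HasEKR (unionΩ Ω) (prodList G)
theorem5p3 n k _ Ω G _ Ω-disjoint G-group G-ekr = proj₂ (prodList-groupWithEKR k Ω G Ω-disjoint G-group G-ekr)
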